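{- Let $G=(V,E)$ be a graph with $V=\{v_1,\dots,v_n\}$, let $k$ be a positive integer, and let $G'$ be the graph constructed from $(G,k)$ as described in the context, with $k'=1+kn+\sum_{v\in V}k(\delta(v)+1)$. If $G$ has a dominating set of size $k$, then $G'$ has a safe set of size $k'$.
   Context: $\delta(v)$ is the degree of $v$ in $G$, $N[v]$ the closed neighborhood. A dominating set of $G$ is a set $K$ with $N[v]\cap K\neq\emptyset$ for all $v$. A non-empty set $S\subseteq V(H)$ is a safe set of a graph $H$ if no connected component $C$ of $H[S]$ is adjacent (joined by an edge) to a connected component $D$ of $H-S$ with $|C|<|D|$. Construction of $G'$: (1) For each $j\in[k]$ create a cycle ("line") $V^j$ on vertices $v^j_1,\dots,v^j_{n^2}$ in this cyclic order; for $a,b\in[n]$ the vertex $v^j_{(b-1)n+a}$ is called the copy of $v_a$ in the $b$-th block of line $j$. (2) For each $j\in[k]$ and $b\in[n]$ attach to $v^j_{(b-1)n+1}$ a set $B^j_b$ of $k'-n+1$ new pendant vertices. (3) For each $i\in[n]$ build a gadget $\hat D_i$: a central vertex $z^i$ with a set $W^i$ of $k'-k(\delta(v_i)+1)$ new pendant vertices; for each $j\in[k]$ an independent set $X^i_j=\{x^{i,j}_w : w\in N[v_i]\}$ and an independent set $Y^i_j=\{y^{i,j}_w: w\in N[v_i]\}$, with edges $x^{i,j}_w y^{i,j}_w$ and $z^i y^{i,j}_w$ for all $w$, and each $x=x^{i,j}_w$ gets a set $Q_x$ of $k'-1$ new pendant vertices. (4) For all $i\in[n]$, $j\in[k]$,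 $a$ with $v_a\in N[v_i]$, add the edge between $x^{i,j}_{v_a}$ and $v^j_{(i-1)n+a}$ (the copy of $v_a$ in the $i$-th block of line $j$). (5) Add a universal vertex $u$ adjacent to all other vertices. -}

module Defs where

open import Data.Nat using (ℕ; zero; suc; _+_; _*_; _∸_; _≤_)
open import Data.Bool using (Bool; true; false; if_then_else_; _∨_; T)
open import Data.Fin using (Fin; toℕ; _≟_)
open import Data.List using (List; []; length; map; allFin)
open import Data.Nat.ListAction using (sum)
open import Data.List.Membership.Propositional using (_∈_; _∉_)
open import Data.List.Relation.Unary.Unique.Propositional using (Unique)
open import Data.Product using (Σ; ∃; _×_; _,_)
open import Data.Sum using (_⊎_)
open import Relation.Binary.PropositionalEquality using (_≡_; _≢_)
open import Relation.Nullary.Decidable using (⌊_⌋)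

-- Finite simple graphs G with vertex set {v_1,…,v_n} = Fin n
-- (vertex v_{i+1} is represented by i : Fin n).

record SimpleGraph : Set where
  field
    n      : ℕ
    adj    : Fin n → Fin n → Bool
    sym    : ∀ a b → adj a b ≡ adj b a
    irrefl : ∀ a → adj a a ≡ false

module _ (G : SimpleGraph) where
  open SimpleGraph G

  deg : Fin n → ℕ
  deg i = sum (map (λ w → if adj i w then 1 else 0) (allFin n))

  inN : Fin n → Fin n → Bool
  inN i w = ⌊ i ≟ w ⌋ ∨ adj i w

  IsDominatingSet : List (Fin n) → Set
  IsDominatingSet K = Unique K × (∀ v → ∃ λ w → w ∈ K × T (inN v w))

  k′ : ℕ → ℕ
  k′ k = 1 + k * n + sum (map (λ i → k * (deg i + 1)) (allFin n))

module _ {V : Set} (Adj : V → V → Set) where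

  data PathIn (Q : V → Set) : V → V → Set where
    here : ∀ {x} → Q x → PathIn Q x x
    step : ∀ {x y z} → Q x → Adj x y → PathIn Q y z → PathIn Q x z

  IsComponent : (V → Set) → List V → Set
  IsComponent P C =
      C ≢ []
    × (∀ x → x ∈ C → P x)
    × (∀ x y → x ∈ C → y ∈ C → PathIn (_∈ C) x y)
    × (∀ x y → x ∈ C → P y → Adj x y → y ∈ C)

  IsSafeSet : List V → Set
  IsSafeSet S =
      S ≢ []
    × (∀ C D → Unique C → Unique D
         → IsComponent (_∈ S) C → IsComponent (_∉ S) D
         → (∃ λ c → ∃ λ d → c ∈ C × d ∈ D × Adj c d)
         → length D ≤ length C)

-- The construction of G' from (G, k).  0-based indices: line j : Fin k,
-- block b : Fin n, position a : Fin n; line j b a is v^j_{b n + a + 1}.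

module Construction (G : SimpleGraph) (k : ℕ) where
  open SimpleGraph G

  K′ : ℕ
  K′ = k′ G k

  data V′ : Set where
    line : (j : Fin k) (b a : Fin n) → V′
    bpen : (j : Fin k) (b : Fin n) → Fin ((K′ ∸ n) + 1) → V′
    zv   : (i : Fin n) → V′
    wpen : (i : Fin n) → Fin (K′ ∸ k * (deg G i + 1)) → V′
    xv   : (i : Fin n) (j : Fin k) (w : Fin n) → T (inN G i w) → V′
    yv   : (i : Fin n) (j : Fin k) (w : Fin n) → T (inN G i w) → V′
    qpen : (i : Fin n) (j : Fin k) (w : Fin n) → T (inN G i w) → Fin (K′ ∸ 1) → V′
    uv   : V′

  idx : Fin n → Fin n → ℕ
  idx b a = toℕ b * n + toℕ a

  Next : Fin n → Fin n → Fin n → Fin n → Set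
  Next b a b′ a′ = (suc (idx b a) ≡ idx b′ a′)
                 ⊎ (idx b a ≡ n * n ∸ 1 × idx b′ a′ ≡ 0)

  data E : V′ → V′ → Set where
    e-cyc : ∀ j b a b′ a′ → Next b a b′ a′ → E (line j b a) (line j b′ a′)
    e-bpen : ∀ j b t a → toℕ a ≡ 0 → E (bpen j b t) (line j b a)
    e-wpen : ∀ i t → E (wpen i t) (zv i)
    e-xy  : ∀ i j w p → E (xv i j w p) (yv i j w p)
    e-zy  : ∀ i j w p → E (zv i) (yv i j w p)
    e-qpen : ∀ i j w p t → E (qpen i j w p t) (xv i j w p)
    e-xline : ∀ i j w p → E (xv i j w p) (line j i w)
    e-u   : ∀ v → v ≢ uv → E uv v

  Adj′ : V′ → V′ → Set
  Adj′ v w = E v w ⊎ E w v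

Fin′ : SimpleGraph → Set
Fin′ G = Fin (SimpleGraph.n G)

-- Let d_1, …, d_k enumerate the dominating set. Take S to consist of u, the copy of d_j in
-- every block of line j, and, for every i, j and w ∈ N[v_i], the vertex y^{i,j}_w if w = d_j
-- and x^{i,j}_w otherwise; then |S| = k'. As u is universal, G'[S] is connected, so S is safe
-- once every component of G' - S has at most k' vertices. Such a component is
--  * x^{i,j}_{d_j} with its k' - 1 pendants;
--  * part of z^i, W^i and the y-vertices of gadget i; it misses y^{i,j}_{d_j} for some d_j
--    dominating v_i, which leaves at most 1 + |W^i| + k(δ(v_i) + 1) - 1 = k' vertices;
--  * the n - 1 line vertices strictly between two consecutive copies of d_j on line j, with
--    the k' - n + 1 pendants of the block-first vertex among them;
--  * a single pendant of a block-first vertex that is itself in S.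
module Submission where

open import Defs
open import Data.Nat using (ℕ; zero; suc; _+_; _*_; _∸_; _≤_; _<_; z≤n; s≤s; s≤s⁻¹)
import Data.Nat as ℕ
open import Data.Nat.Properties hiding (_≟_)
open import Data.Nat.ListAction using (sum)
open import Data.Bool using (Bool; true; false; if_then_else_; _∨_; T)
open import Data.Bool.Properties using (T-irrelevant)
open import Data.Unit using (tt)
open import Data.Maybe using (Maybe; just; nothing)
import Data.Maybe as Maybe
open import Data.Maybe.Properties using (just-injective)
open import Data.Fin using (Fin; toℕ; _≟_; fromℕ; inject₁) renaming (zero to fzero; suc to fsuc)
open import Data.Fin.Properties using (toℕ-injective; toℕ<n; toℕ-fromℕ; toℕ-inject₁)
open import Data.List using (List; []; _∷_; length; map; allFin; _++_; concatMap; applyUpTo; lookup)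
open import Data.List.Properties using (length-++; length-map; length-tabulate; length-applyUpTo; length-removeAt′; map-tabulate; map-cong)
open import Data.List.Membership.Propositional using (_∈_; _∉_; find; lose)
open import Data.List.Membership.Propositional.Properties
open import Data.List.Relation.Unary.Any using (here; there; _─_; index)
open import Data.List.Relation.Unary.Any.Properties using (lookup-index)
import Data.List.Relation.Unary.All as All
open import Data.List.Relation.Unary.AllPairs using ([]; _∷_)
open import Data.List.Relation.Unary.Unique.Propositional using (Unique)
import Data.List.Relation.Unary.Unique.Propositional.Properties as Unique
open import Data.List.Relation.Binary.Subset.Propositional using (_⊆_)
open import Data.Product using (Σ; ∃; _×_; _,_; proj₁; proj₂)
open import Data.Sum using (_⊎_; inj₁; inj₂)
import Data.Sum as Sum
open import Data.Empty using (⊥-elim)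
open import Function using (_∘_)
open import Relation.Nullary using (¬_; yes; no)
open import Relation.Nullary.Decidable using (⌊_⌋; toWitness)
open import Relation.Binary.PropositionalEquality
open import Relation.Binary.Definitions using (Symmetric; tri<; tri≈; tri>)

private variable
  A B : Set

∈-─⁺ : ∀ {x y} {xs : List A} (x∈xs : x ∈ xs) → y ∈ xs → y ≢ x → y ∈ (xs ─ x∈xs)
∈-─⁺ (here refl) (here refl)  y≢x = ⊥-elim (y≢x refl)
∈-─⁺ (here refl) (there y∈xs) y≢x = y∈xs
∈-─⁺ (there x∈xs) (here refl)  y≢x = here refl
∈-─⁺ (there x∈xs) (there y∈xs) y≢x = there (∈-─⁺ x∈xs y∈xs y≢x)

length-mono-⊆ : {xs ys : List A} → Unique xs → xs ⊆ ys → length xs ≤ length ys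
length-mono-⊆ {xs = []}     _          _     = z≤n
length-mono-⊆ {xs = x ∷ xs} {ys} (x∉xs ∷ u) xs⊆ys = begin
  suc (length xs)                 ≤⟨ s≤s (length-mono-⊆ u xs⊆ys─x) ⟩
  suc (length (ys ─ x∈ys))        ≡⟨ length-removeAt′ ys _ ⟨
  length ys                       ∎
  where
    open ≤-Reasoning
    x∈ys = xs⊆ys (here refl)
    xs⊆ys─x : xs ⊆ (ys ─ x∈ys)
    xs⊆ys─x y∈xs = ∈-─⁺ x∈ys (xs⊆ys (there y∈xs)) (λ y≡x → All.lookup x∉xs y∈xs (sym y≡x))

Unique-map-injectiveOn : (f : A → B) {xs : List A}
  → (∀ {x y} → x ∈ xs → y ∈ xs → f x ≡ f y → x ≡ y) → Unique xs → Unique (map f xs)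
Unique-map-injectiveOn f _   []           = []
Unique-map-injectiveOn f inj (x∉xs ∷ u) =
  All.tabulate fx∉ ∷ Unique-map-injectiveOn f (λ x∈ y∈ → inj (there x∈) (there y∈)) u
  where
    fx∉ : ∀ {z} → z ∈ map f _ → f _ ≢ z
    fx∉ z∈ fx≡z with y , y∈xs , refl ← ∈-map⁻ f z∈ =
      All.lookup x∉xs y∈xs (inj (here refl) (there y∈xs) fx≡z)

length≤-injective-into-interval : (f : A → ℕ) (lo m : ℕ) {xs : List A} → Unique xs
  → (∀ {x y} → x ∈ xs → y ∈ xs → f x ≡ f y → x ≡ y)
  → (∀ {x} → x ∈ xs → lo ≤ f x × f x < lo + m)
  → length xs ≤ m
length≤-injective-into-interval f lo m {xs} u inj range = begin
  length xs                           ≡⟨ length-map f xs ⟨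
  length (map f xs)                   ≤⟨ length-mono-⊆ (Unique-map-injectiveOn f inj u) fxs⊆interval ⟩
  length (applyUpTo (lo +_) m)        ≡⟨ length-applyUpTo (lo +_) m ⟩
  m                                   ∎
  where
    open ≤-Reasoning
    fxs⊆interval : map f xs ⊆ applyUpTo (lo +_) m
    fxs⊆interval z∈ with x , x∈xs , refl ← ∈-map⁻ f z∈ =
      let lo≤fx , fx<lo+m = range x∈xs in
      subst (_∈ applyUpTo (lo +_) m) (m+[n∸m]≡n lo≤fx)
        (∈-applyUpTo⁺ (lo +_) (+-cancelˡ-< lo _ _ (subst (_< lo + m) (sym (m+[n∸m]≡n lo≤fx)) fx<lo+m)))

length-concatMap : (f : A → List B) (xs : List A) → length (concatMap f xs) ≡ sum (map (length ∘ f) xs)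
length-concatMap f []       = refl
length-concatMap f (x ∷ xs) = trans (length-++ (f x)) (cong (length (f x) +_) (length-concatMap f xs))

Unique-concatMap : {f : A → List B} (key : B → Maybe A) → (∀ {x b} → b ∈ f x → key b ≡ just x)
  → ∀ {xs} → Unique xs → (∀ x → Unique (f x)) → Unique (concatMap f xs)
Unique-concatMap key keyed {[]}     _          _       = []
Unique-concatMap {f = f} key keyed {x ∷ xs} (x∉xs ∷ u) unique-f =
  Unique.++⁺ (unique-f x) (Unique-concatMap key keyed u unique-f) disjoint
  where
    disjoint : ∀ {b} → ¬ (b ∈ f x × b ∈ concatMap f xs)
    disjoint (b∈fx , b∈rest) with y , y∈xs , b∈fy ← find (∈-concatMap⁻ f {xs = xs} b∈rest) =
      All.lookup x∉xs y∈xs (just-injective (trans (sym (keyed b∈fx)) (keyed b∈fy)))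

≤-sum-map : (f : A → ℕ) {x : A} {xs : List A} → x ∈ xs → f x ≤ sum (map f xs)
≤-sum-map f (here refl)  = m≤m+n _ _
≤-sum-map f (there x∈xs) = ≤-trans (≤-sum-map f x∈xs) (m≤n+m _ _)

length-concatMap-const : {f : A → List B} {c : ℕ} → (∀ x → length (f x) ≡ c)
  → ∀ xs → length (concatMap f xs) ≡ length xs * c
length-concatMap-const same-length []       = refl
length-concatMap-const {f = f} same-length (x ∷ xs) =
  trans (length-++ (f x)) (cong₂ _+_ (same-length x) (length-concatMap-const same-length xs))

sum-map-const : (c : ℕ) (xs : List A) → sum (map (λ _ → c) xs) ≡ length xs * c
sum-map-const c []       = refl
sum-map-const c (x ∷ xs) = cong (c +_) (sum-map-const c xs)

length-allFin : ∀ n → length (allFin n) ≡ n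
length-allFin n = length-tabulate (λ i → i)

count : (A → Bool) → List A → ℕ
count p xs = sum (map (λ x → if p x then 1 else 0) xs)

count-∨ : (p q : A → Bool) → (∀ x → T (p x) → q x ≡ false)
  → ∀ xs → count (λ x → p x ∨ q x) xs ≡ count p xs + count q xs
count-∨ p q disjoint []       = refl
count-∨ p q disjoint (x ∷ xs) with p x in px | q x in qx
... | false | false = count-∨ p q disjoint xs
... | false | true  = trans (cong suc (count-∨ p q disjoint xs)) (sym (+-suc _ _))
... | true  | false = cong suc (count-∨ p q disjoint xs)
... | true  | true  with () ← trans (sym qx) (disjoint x (subst T (sym px) tt))

count-cong : {p q : A → Bool} → (∀ x → p x ≡ q x) → ∀ xs → count p xs ≡ count q xs
count-cong p≗q xs = cong sum (map-cong (λ x → cong (λ b → if b then 1 else 0) (p≗q x)) xs)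

count-allFin-suc : ∀ {n} (p : Fin (suc n) → Bool)
  → count p (allFin (suc n)) ≡ (if p fzero then 1 else 0) + count (p ∘ fsuc) (allFin n)
count-allFin-suc {n} p = cong (λ bits → (if p fzero then 1 else 0) + sum bits)
  (trans (map-tabulate fsuc bit) (sym (map-tabulate (λ i → i) (bit ∘ fsuc))))
  where
    bit : Fin (suc n) → ℕ
    bit x = if p x then 1 else 0

count-≟ : ∀ {n} (i : Fin n) → count (λ w → ⌊ i ≟ w ⌋) (allFin n) ≡ 1
count-≟ {suc n} fzero = begin
  count (λ w → ⌊ fzero ≟ w ⌋) (allFin (suc n))  ≡⟨ count-allFin-suc {n} (λ w → ⌊ fzero ≟ w ⌋) ⟩
  1 + count (λ _ → false) (allFin n)            ≡⟨ cong suc (sum-map-const 0 (allFin n)) ⟩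
  1 + length (allFin n) * 0                     ≡⟨ cong suc (*-zeroʳ (length (allFin n))) ⟩
  1                                             ∎
  where open ≡-Reasoning
count-≟ {suc n} (fsuc i) = begin
  count (λ w → ⌊ fsuc i ≟ w ⌋) (allFin (suc n))  ≡⟨ count-allFin-suc {n} (λ w → ⌊ fsuc i ≟ w ⌋) ⟩
  count (λ w → ⌊ fsuc i ≟ fsuc w ⌋) (allFin n)  ≡⟨ count-cong ≟-fsuc (allFin n) ⟩
  count (λ w → ⌊ i ≟ w ⌋) (allFin n)            ≡⟨ count-≟ i ⟩
  1                                             ∎
  where
    open ≡-Reasoning
    ≟-fsuc : ∀ w → ⌊ fsuc i ≟ fsuc w ⌋ ≡ ⌊ i ≟ w ⌋
    ≟-fsuc w with i ≟ w
    ... | yes _ = refl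
    ... | no  _ = refl

consIf : (b : Bool) → (T b → A) → List A → List A
consIf true  f ys = f tt ∷ ys
consIf false f ys = ys

module _ {ys : List A} where

  length-consIf : ∀ {b} {f : T b → A} → length (consIf b f ys) ≡ (if b then 1 else 0) + length ys
  length-consIf {true}  = refl
  length-consIf {false} = refl

  ∈-consIf⁺ˡ : ∀ {b} {f : T b → A} (p : T b) → f p ∈ consIf b f ys
  ∈-consIf⁺ˡ {true} p = here refl

  ∈-consIf⁺ʳ : ∀ {b} {f : T b → A} {y} → y ∈ ys → y ∈ consIf b f ys
  ∈-consIf⁺ʳ {true}  y∈ys = there y∈ys
  ∈-consIf⁺ʳ {false} y∈ys = y∈ys

  ∈-consIf⁻ : ∀ {b} {f : T b → A} {y} → y ∈ consIf b f ys → (Σ (T b) λ p → y ≡ f p) ⊎ y ∈ ys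
  ∈-consIf⁻ {true}  (here refl) = inj₁ (tt , refl)
  ∈-consIf⁻ {true}  (there y∈)  = inj₂ y∈
  ∈-consIf⁻ {false} y∈          = inj₂ y∈

  Unique-consIf : ∀ {b} {f : T b → A} → (∀ p → f p ∉ ys) → Unique ys → Unique (consIf b f ys)
  Unique-consIf {true}  fresh u = All.tabulate (λ y∈ys fp≡y → fresh tt (subst (_∈ ys) (sym fp≡y) y∈ys)) ∷ u
  Unique-consIf {false} fresh u = u

module _ (P : A → Bool) where

  witnesses : List A → List (Σ A (T ∘ P))
  witnesses []       = []
  witnesses (x ∷ xs) = consIf (P x) (x ,_) (witnesses xs)

  length-witnesses : ∀ xs → length (witnesses xs) ≡ count P xs
  length-witnesses []       = refl
  length-witnesses (x ∷ xs) = trans (length-consIf {b = P x}) (cong (_ +_) (length-witnesses xs))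

  ∈-witnesses⁺ : ∀ {x xs} → x ∈ xs → (p : T (P x)) → (x , p) ∈ witnesses xs
  ∈-witnesses⁺ (here refl)  p = ∈-consIf⁺ˡ p
  ∈-witnesses⁺ (there x∈xs) p = ∈-consIf⁺ʳ (∈-witnesses⁺ x∈xs p)

  ∈-witnesses⁻ : ∀ {x p} xs → (x , p) ∈ witnesses xs → x ∈ xs
  ∈-witnesses⁻ (y ∷ xs) x∈ with ∈-consIf⁻ {b = P y} {f = y ,_} x∈
  ... | inj₁ (_ , refl) = here refl
  ... | inj₂ x∈rest     = there (∈-witnesses⁻ xs x∈rest)

  Unique-witnesses : ∀ {xs} → Unique xs → Unique (witnesses xs)
  Unique-witnesses {[]}     []         = []
  Unique-witnesses {x ∷ xs} (x∉xs ∷ u) =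
    Unique-consIf (λ p x∈ → All.lookup x∉xs (∈-witnesses⁻ xs x∈) refl) (Unique-witnesses u)

module _ {V : Set} {Adj : V → V → Set} where

  component-invariant : ∀ {Q : V → Set} {D} → IsComponent Adj Q D
    → (P : V → Set) → (∀ {v w} → Adj v w → Q v → Q w → P v → P w)
    → ∀ {x} → x ∈ D → P x → ∀ {y} → y ∈ D → P y
  component-invariant {Q} {D} (_ , inQ , connected , _) P preserved {x} x∈D Px {y} y∈D =
    along (connected x y x∈D y∈D) Px
    where
      start : ∀ {a b} → PathIn Adj (_∈ D) a b → a ∈ D
      start (here a∈D)     = a∈D
      start (step a∈D _ _) = a∈D
      along : ∀ {a b} → PathIn Adj (_∈ D) a b → P a → P b
      along (here _)             Pa = Pa
      along (step a∈D a~c c⇝b) Pa =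
        along c⇝b (preserved a~c (inQ _ a∈D) (inQ _ (start c⇝b)) Pa)

  ⊆-component-of-universal : ∀ {S C u} → Symmetric Adj → (∀ v → u ≡ v ⊎ Adj u v) → u ∈ S
    → IsComponent Adj (_∈ S) C → S ⊆ C
  ⊆-component-of-universal {S} {[]}    sym-adj universal u∈S (C≢[] , _) = ⊥-elim (C≢[] refl)
  ⊆-component-of-universal {S} {c ∷ C} {u} sym-adj universal u∈S (_ , _ , _ , closed) = S⊆C
    where
      u∈C : u ∈ c ∷ C
      u∈C with universal c
      ... | inj₁ refl = here refl
      ... | inj₂ u~c  = closed c u (here refl) u∈S (sym-adj u~c)
      S⊆C : S ⊆ c ∷ C
      S⊆C {x} x∈S with universal x
      ... | inj₁ refl = u∈C
      ... | inj₂ u~x  = closed u x u∈C x∈S u~x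

  IsSafeSet-of-universal : ∀ {S u} → Symmetric Adj → (∀ v → u ≡ v ⊎ Adj u v) → u ∈ S → Unique S
    → (∀ D → Unique D → IsComponent Adj (_∉ S) D → length D ≤ length S)
    → IsSafeSet Adj S
  IsSafeSet-of-universal {S} sym-adj universal u∈S unique-S small-D = S≢[] , safe
    where
      S≢[] : S ≢ []
      S≢[] S≡[] with () ← subst (_ ∈_) S≡[] u∈S
      safe : ∀ C D → Unique C → Unique D → IsComponent Adj (_∈ S) C → IsComponent Adj (_∉ S) D
        → (∃ λ c → ∃ λ d → c ∈ C × d ∈ D × Adj c d) → length D ≤ length C
      safe C D _ unique-D C-comp D-comp _ = ≤-trans (small-D D unique-D D-comp)
        (length-mono-⊆ unique-S (⊆-component-of-universal sym-adj universal u∈S C-comp))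

quotRem-unique : ∀ n {b a b′ a′} → a < n → a′ < n → b * n + a ≡ b′ * n + a′ → b ≡ b′ × a ≡ a′
quotRem-unique n {zero}  {a} {zero}    _   _    eq = refl , eq
quotRem-unique n {zero}  {a} {suc b′} {a′} a<n _ eq =
  ⊥-elim (<⇒≱ a<n (subst (n ≤_) (sym eq) (≤-trans (m≤m+n n (b′ * n)) (m≤m+n _ a′))))
quotRem-unique n {suc b} {a} {zero}  {a′} _ a′<n eq =
  ⊥-elim (<⇒≱ a′<n (subst (n ≤_) eq (≤-trans (m≤m+n n (b * n)) (m≤m+n _ a))))
quotRem-unique n {suc b} {a} {suc b′} {a′} a<n a′<n eq =
  let b≡b′ , a≡a′ = quotRem-unique n a<n a′<n
                     (+-cancelˡ-≡ n _ _ (trans (sym (+-assoc n (b * n) a)) (trans eq (+-assoc n (b′ * n) a′))))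
  in cong suc b≡b′ , a≡a′

module _ {n : ℕ} where

  Succ : Fin n → Fin n → Set
  Succ b b′ = toℕ b′ ≡ suc (toℕ b) ⊎ (toℕ b ≡ n ∸ 1 × toℕ b′ ≡ 0)

  suc[n∸1]≡n : Fin n → suc (n ∸ 1) ≡ n
  suc[n∸1]≡n b = m+[n∸m]≡n (≤-trans (s≤s z≤n) (toℕ<n b))

  Succ-functional : ∀ {b₀ b b′} → Succ b₀ b → Succ b₀ b′ → b ≡ b′
  Succ-functional (inj₁ e) (inj₁ e′) = toℕ-injective (trans e (sym e′))
  Succ-functional {b = b}  (inj₁ e) (inj₂ (last , _)) =
    ⊥-elim (<-irrefl (trans e (trans (cong suc last) (suc[n∸1]≡n b))) (toℕ<n b))
  Succ-functional {b′ = b′} (inj₂ (last , _)) (inj₁ e) =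
    ⊥-elim (<-irrefl (trans e (trans (cong suc last) (suc[n∸1]≡n b′))) (toℕ<n b′))
  Succ-functional (inj₂ (_ , e)) (inj₂ (_ , e′)) = toℕ-injective (trans e (sym e′))

  Succ-injective : ∀ {b₀ b₁ b} → Succ b₀ b → Succ b₁ b → b₀ ≡ b₁
  Succ-injective (inj₁ e)       (inj₁ e′)       = toℕ-injective (suc-injective (trans (sym e) e′))
  Succ-injective (inj₁ e)       (inj₂ (_ , e′)) with () ← trans (sym e) e′
  Succ-injective (inj₂ (_ , e)) (inj₁ e′)       with () ← trans (sym e′) e
  Succ-injective (inj₂ (e , _)) (inj₂ (e′ , _)) = toℕ-injective (trans e (sym e′))

  Succ-refl⇒n≡1 : ∀ {b} → Succ b b → n ≡ 1
  Succ-refl⇒n≡1 {b} (inj₁ e) = ⊥-elim (<-irrefl e (n<1+n (toℕ b)))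
  Succ-refl⇒n≡1 {b} (inj₂ (last , first)) =
    trans (sym (suc[n∸1]≡n b)) (cong suc (trans (sym last) first))

  Step : Fin n → Fin n → Fin n → Fin n → Set
  Step b a b′ a′ = (b′ ≡ b × toℕ a′ ≡ suc (toℕ a)) ⊎ (toℕ a ≡ n ∸ 1 × toℕ a′ ≡ 0 × Succ b b′)

  InSegment : ℕ → Fin n → Fin n → ℕ → Set
  InSegment d b₀ b a = (b ≡ b₀ × d < a) ⊎ (Succ b₀ b × a < d)

  <n⇒≤n∸1 : ∀ {d} → Fin n → d < n → d ≤ n ∸ 1
  <n⇒≤n∸1 b d<n = s≤s⁻¹ (subst (_ ≤_) (sym (suc[n∸1]≡n b)) d<n)

  InSegment-step : ∀ {d b₀ b b′ a a′} → d < n → InSegment d b₀ b (toℕ a) → Step b a b′ a′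
    → toℕ a′ ≢ d → InSegment d b₀ b′ (toℕ a′)
  InSegment-step _ (inj₁ (refl , d<a)) (inj₁ (refl , a′≡1+a)) _ =
    inj₁ (refl , subst (_ <_) (sym a′≡1+a) (m<n⇒m<1+n d<a))
  InSegment-step _ (inj₁ (refl , _)) (inj₂ (_ , a′≡0 , succ)) a′≢d =
    inj₂ (succ , subst (_< _) (sym a′≡0) (n≢0⇒n>0 (λ d≡0 → a′≢d (trans a′≡0 (sym d≡0)))))
  InSegment-step _ (inj₂ (succ , a<d)) (inj₁ (refl , a′≡1+a)) a′≢d =
    inj₂ (succ , ≤∧≢⇒< (subst (_≤ _) (sym a′≡1+a) a<d) a′≢d)
  InSegment-step {a = a} d<n (inj₂ (_ , a<d)) (inj₂ (a-last , _ , _)) _ =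
    ⊥-elim (<⇒≱ a<d (subst (_ ≤_) (sym a-last) (<n⇒≤n∸1 a d<n)))

  InSegment-step⁻ : ∀ {d b₀ b b′ a a′} → d < n → InSegment d b₀ b′ (toℕ a′) → Step b a b′ a′
    → toℕ a ≢ d → InSegment d b₀ b (toℕ a)
  InSegment-step⁻ _ (inj₁ (refl , d<a′)) (inj₁ (refl , a′≡1+a)) a≢d =
    inj₁ (refl , ≤∧≢⇒< (s≤s⁻¹ (subst (_ <_) a′≡1+a d<a′)) (≢-sym a≢d))
  InSegment-step⁻ _ (inj₁ (_ , d<a′)) (inj₂ (_ , a′≡0 , _)) _ with () ← subst (_ <_) a′≡0 d<a′
  InSegment-step⁻ _ (inj₂ (succ , a′<d)) (inj₁ (refl , a′≡1+a)) _ =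
    inj₂ (succ , <-trans (subst (_ <_) (sym a′≡1+a) (n<1+n _)) a′<d)
  InSegment-step⁻ {a = a} d<n (inj₂ (succ₀ , _)) (inj₂ (a-last , _ , succ)) a≢d =
    inj₁ (Succ-injective succ succ₀ , ≤∧≢⇒< (subst (_ ≤_) (sym a-last) (<n⇒≤n∸1 a d<n)) (≢-sym a≢d))

Succ-predecessor : ∀ {n} (b : Fin n) → ∃ λ b₀ → Succ b₀ b
Succ-predecessor {suc m} fzero    = fromℕ m , inj₂ (toℕ-fromℕ m , refl)
Succ-predecessor {suc m} (fsuc c) = inject₁ c , inj₁ (cong suc (sym (toℕ-inject₁ c)))

-- The hypothesis is Construction.Next b a b′ a′, unfolded.
next⇒Step : ∀ {n} {b a b′ a′ : Fin n}
  → (suc (toℕ b * n + toℕ a) ≡ toℕ b′ * n + toℕ a′) ⊎ (toℕ b * n + toℕ a ≡ n * n ∸ 1 × toℕ b′ * n + toℕ a′ ≡ 0)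
  → Step b a b′ a′
next⇒Step {suc m} {b} {a} {b′} {a′} (inj₁ eq) with suc (toℕ a) ℕ.≟ suc m
... | yes a-last =
  let b+1≡b′ , 0≡a′ = quotRem-unique (suc m) {suc (toℕ b)} (s≤s z≤n) (toℕ<n a′) (begin
        suc m + toℕ b * suc m + 0      ≡⟨ +-identityʳ _ ⟩
        suc m + toℕ b * suc m          ≡⟨ +-comm (suc m) _ ⟩
        toℕ b * suc m + suc m          ≡⟨ cong (toℕ b * suc m +_) a-last ⟨
        toℕ b * suc m + suc (toℕ a)    ≡⟨ +-suc _ _ ⟩
        suc (toℕ b * suc m + toℕ a)    ≡⟨ eq ⟩
        toℕ b′ * suc m + toℕ a′        ∎)
  in inj₂ (suc-injective a-last , sym 0≡a′ , inj₁ (sym b+1≡b′))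
  where open ≡-Reasoning
... | no a-not-last =
  let b≡b′ , a+1≡a′ = quotRem-unique (suc m) (≤∧≢⇒< (toℕ<n a) a-not-last) (toℕ<n a′)
                        (trans (+-suc _ _) eq)
  in inj₁ (toℕ-injective (sym b≡b′) , sym a+1≡a′)
next⇒Step {suc m} {b} {a} {b′} {a′} (inj₂ (eq-last , eq-first)) =
  let b-last , a-last = quotRem-unique (suc m) (toℕ<n a) ≤-refl (trans eq-last (+-comm m (m * suc m)))
      b′-first , a′-first = quotRem-unique (suc m) {a′ = 0} (toℕ<n a′) (s≤s z≤n) eq-first
  in inj₂ (a-last , a′-first , inj₂ (b-last , b′-first))

module SafeSetOfDominatingSet (G : SimpleGraph) (K : List (Fin′ G))
  (dominating : IsDominatingSet G K) (k≥1 : 1 ≤ length K) where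

  open SimpleGraph G using (n; adj; irrefl)
  open Construction G (length K)

  k : ℕ
  k = length K

  d : Fin k → Fin n
  d = lookup K

  N[_] : (i : Fin n) → List (Σ (Fin n) (T ∘ inN G i))
  N[ i ] = witnesses (inN G i) (allFin n)

  length-N : ∀ i → length N[ i ] ≡ deg G i + 1
  length-N i = begin
    length N[ i ]                                    ≡⟨ length-witnesses (inN G i) (allFin n) ⟩
    count (λ w → ⌊ i ≟ w ⌋ ∨ adj i w) (allFin n)      ≡⟨ count-∨ _ (adj i) adj-i-i (allFin n) ⟩
    count (λ w → ⌊ i ≟ w ⌋) (allFin n) + deg G i      ≡⟨ cong (_+ deg G i) (count-≟ i) ⟩
    1 + deg G i                                      ≡⟨ +-comm 1 (deg G i) ⟩
    deg G i + 1                                      ∎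
    where
      open ≡-Reasoning
      adj-i-i : ∀ w → T ⌊ i ≟ w ⌋ → adj i w ≡ false
      adj-i-i w i≡w = subst (λ w → adj i w ≡ false) (toWitness i≡w) (irrefl i)

  selected : (i : Fin n) (j : Fin k) → Σ (Fin n) (T ∘ inN G i) → V′
  selected i j (w , p) with w ≟ d j
  ... | yes _ = yv i j w p
  ... | no  _ = xv i j w p

  lineS : List V′
  lineS = concatMap (λ j → map (λ b → line j b (d j)) (allFin n)) (allFin k)

  gadgetS : Fin n → List V′
  gadgetS i = concatMap (λ j → map (selected i j) N[ i ]) (allFin k)

  xyS : List V′
  xyS = concatMap gadgetS (allFin n)

  S : List V′
  S = uv ∷ lineS ++ xyS

  length-concatMap-N : ∀ i (g : Fin k → Σ (Fin n) (T ∘ inN G i) → V′)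
    → length (concatMap (λ j → map (g j) N[ i ]) (allFin k)) ≡ k * (deg G i + 1)
  length-concatMap-N i g = trans
    (length-concatMap-const (λ j → trans (length-map (g j) N[ i ]) (length-N i)) (allFin k))
    (cong (_* (deg G i + 1)) (length-allFin k))

  length-S : length S ≡ K′
  length-S = cong suc (begin
    length (lineS ++ xyS)                      ≡⟨ length-++ lineS ⟩
    length lineS + length (xyS)                 ≡⟨ cong₂ _+_ length-lineS length-xyS ⟩
    k * n + sum (map (λ i → k * (deg G i + 1)) (allFin n))               ∎)
    where
      open ≡-Reasoning
      length-lineS : length lineS ≡ k * n
      length-lineS = trans
        (length-concatMap-const (λ j → trans (length-map _ (allFin n)) (length-allFin n)) (allFin k))
        (cong (_* n) (length-allFin k))
      length-xyS : length (xyS) ≡ sum (map (λ i → k * (deg G i + 1)) (allFin n))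
      length-xyS = trans (length-concatMap gadgetS (allFin n))
        (cong sum (map-cong (λ i → length-concatMap-N i (selected i)) (allFin n)))

  line∈S : ∀ j b → line j b (d j) ∈ S
  line∈S j b = there (∈-++⁺ˡ (∈-concatMap⁺ _ (lose (∈-allFin j) (∈-map⁺ _ (∈-allFin b)))))

  selected∈S : ∀ i j w (p : T (inN G i w)) → selected i j (w , p) ∈ S
  selected∈S i j w p = there (∈-++⁺ʳ lineS (∈-concatMap⁺ gadgetS (lose (∈-allFin i)
    (∈-concatMap⁺ _ (lose (∈-allFin j) (∈-map⁺ (selected i j) (∈-witnesses⁺ (inN G i) (∈-allFin w) p)))))))

  x∈S : ∀ {i j w p} → w ≢ d j → xv i j w p ∈ S
  x∈S {i} {j} {w} {p} w≢dj with w ≟ d j | selected∈S i j w p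
  ... | yes w≡dj | _    = ⊥-elim (w≢dj w≡dj)
  ... | no  _    | x∈S′ = x∈S′

  y∈S : ∀ {i j w p} → w ≡ d j → yv i j w p ∈ S
  y∈S {i} {j} {w} {p} w≡dj with w ≟ d j | selected∈S i j w p
  ... | yes _    | y∈S′ = y∈S′
  ... | no  w≢dj | _    = ⊥-elim (w≢dj w≡dj)

  x∉S⇒≡ : ∀ {i j w p} → xv i j w p ∉ S → w ≡ d j
  x∉S⇒≡ {j = j} {w} x∉S with w ≟ d j
  ... | yes w≡dj = w≡dj
  ... | no  w≢dj = ⊥-elim (x∉S (x∈S w≢dj))

  y∉S⇒≢ : ∀ {i j w p} → yv i j w p ∉ S → w ≢ d j
  y∉S⇒≢ y∉S w≡dj = y∉S (y∈S w≡dj)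

  line∉S⇒≢ : ∀ {j b a} → line j b a ∉ S → a ≢ d j
  line∉S⇒≢ {j} {b} line∉S refl = line∉S (line∈S j b)

  xyIndex : V′ → Maybe (Fin n × Fin k × Fin n)
  xyIndex (xv i j w _) = just (i , j , w)
  xyIndex (yv i j w _) = just (i , j , w)
  xyIndex _            = nothing

  xyIndex-selected : ∀ i j w p → xyIndex (selected i j (w , p)) ≡ just (i , j , w)
  xyIndex-selected i j w p with w ≟ d j
  ... | yes _ = refl
  ... | no  _ = refl

  ∈-lineS⁻ : ∀ {v} → v ∈ lineS → ∃ λ j → ∃ λ b → v ≡ line j b (d j)
  ∈-lineS⁻ v∈ with find (∈-concatMap⁻ _ {xs = allFin k} v∈)
  ... | j , _ , v∈j with ∈-map⁻ _ v∈j
  ...   | b , _ , v≡ = j , b , v≡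

  ∈-gadgetS⁻ : ∀ {i v} → v ∈ gadgetS i → ∃ λ j → ∃ λ w → xyIndex v ≡ just (i , j , w)
  ∈-gadgetS⁻ {i} v∈ with find (∈-concatMap⁻ _ {xs = allFin k} v∈)
  ... | j , _ , v∈j with ∈-map⁻ (selected i j) v∈j
  ...   | (w , p) , _ , refl = j , w , xyIndex-selected i j w p

  ∈-xyS⁻ : ∀ {v} → v ∈ xyS → ∃ λ i → ∃ λ j → ∃ λ w → xyIndex v ≡ just (i , j , w)
  ∈-xyS⁻ v∈ with i , _ , v∈i ← find (∈-concatMap⁻ gadgetS {xs = allFin n} v∈) = i , ∈-gadgetS⁻ v∈i

  selected-injective : ∀ {i j} {wp wp′ : Σ (Fin n) (T ∘ inN G i)} → selected i j wp ≡ selected i j wp′ → wp ≡ wp′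
  selected-injective {i} {j} {w , p} {w′ , p′} eq
    with refl ← trans (sym (xyIndex-selected i j w p)) (trans (cong xyIndex eq) (xyIndex-selected i j w′ p′))
    = cong (w ,_) (T-irrelevant p p′)

  Unique-lineS : Unique lineS
  Unique-lineS = Unique-concatMap lineOf keyed (Unique.allFin⁺ k)
    (λ j → Unique.map⁺ (λ { refl → refl }) (Unique.allFin⁺ n))
    where
      lineOf : V′ → Maybe (Fin k)
      lineOf (line j _ _) = just j
      lineOf _            = nothing
      keyed : ∀ {j v} → v ∈ map (λ b → line j b (d j)) (allFin n) → lineOf v ≡ just j
      keyed v∈ with _ , _ , refl ← ∈-map⁻ _ v∈ = refl

  Unique-gadgetS : ∀ i → Unique (gadgetS i)
  Unique-gadgetS i = Unique-concatMap (Maybe.map (proj₁ ∘ proj₂) ∘ xyIndex) keyed (Unique.allFin⁺ k)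
    (λ j → Unique.map⁺ selected-injective (Unique-witnesses (inN G i) (Unique.allFin⁺ n)))
    where
      keyed : ∀ {j v} → v ∈ map (selected i j) N[ i ] → Maybe.map (proj₁ ∘ proj₂) (xyIndex v) ≡ just j
      keyed {j} v∈ with (w , p) , _ , refl ← ∈-map⁻ (selected i j) v∈ =
        cong (Maybe.map (proj₁ ∘ proj₂)) (xyIndex-selected i j w p)

  Unique-xyS : Unique xyS
  Unique-xyS = Unique-concatMap (Maybe.map proj₁ ∘ xyIndex)
    (λ v∈ → let _ , _ , eq = ∈-gadgetS⁻ v∈ in cong (Maybe.map proj₁) eq) (Unique.allFin⁺ n) Unique-gadgetS

  Unique-S : Unique S
  Unique-S = All.tabulate u∉ ∷ Unique.++⁺ Unique-lineS Unique-xyS lineS∩xyS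
    where
      u∉ : ∀ {v} → v ∈ lineS ++ xyS → uv ≢ v
      u∉ v∈ refl with ∈-++⁻ lineS v∈
      ... | inj₁ u∈lineS with () ← ∈-lineS⁻ u∈lineS
      ... | inj₂ u∈xyS with () ← proj₂ (proj₂ (proj₂ (∈-xyS⁻ u∈xyS)))
      lineS∩xyS : ∀ {v} → ¬ (v ∈ lineS × v ∈ xyS)
      lineS∩xyS (v∈lineS , v∈xyS) with _ , _ , refl ← ∈-lineS⁻ v∈lineS
        with () ← proj₂ (proj₂ (proj₂ (∈-xyS⁻ v∈xyS)))

  Adj′-sym : Symmetric Adj′
  Adj′-sym = Sum.swap

  u-universal : ∀ v → uv ≡ v ⊎ Adj′ uv v
  u-universal uv                  = inj₁ refl
  u-universal v@(line _ _ _)      = inj₂ (inj₁ (e-u v λ ()))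
  u-universal v@(bpen _ _ _)      = inj₂ (inj₁ (e-u v λ ()))
  u-universal v@(zv _)            = inj₂ (inj₁ (e-u v λ ()))
  u-universal v@(wpen _ _)        = inj₂ (inj₁ (e-u v λ ()))
  u-universal v@(xv _ _ _ _)      = inj₂ (inj₁ (e-u v λ ()))
  u-universal v@(yv _ _ _ _)      = inj₂ (inj₁ (e-u v λ ()))
  u-universal v@(qpen _ _ _ _ _)  = inj₂ (inj₁ (e-u v λ ()))

  ClosedOutsideS : (V′ → Set) → Set
  ClosedOutsideS P = ∀ {v w} → Adj′ v w → v ∉ S → w ∉ S → P v → P w

  length≤-cover : ∀ {D} → Unique D → IsComponent Adj′ (_∉ S) D
    → (P : V′ → Set) → ClosedOutsideS P → ∀ {x} → x ∈ D → P x
    → (L : List V′) → (∀ {v} → P v → v ∈ L) → length D ≤ length L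
  length≤-cover unique-D D-comp P closed x∈D Px L cover =
    length-mono-⊆ unique-D (λ v∈D → cover (component-invariant D-comp P closed x∈D Px v∈D))

  n≤K′ : n ≤ K′
  n≤K′ = m≤n⇒m≤1+n (≤-trans (subst (_≤ k * n) (+-identityʳ n) (*-monoˡ-≤ n k≥1)) (m≤m+n _ _))

  gadget-size≤K′ : ∀ i → k * (deg G i + 1) ≤ K′
  gadget-size≤K′ i = m≤n⇒m≤1+n (≤-trans (≤-sum-map _ (∈-allFin i)) (m≤n+m _ (k * n)))

  data XStar (i : Fin n) (j : Fin k) (w : Fin n) (p : T (inN G i w)) : V′ → Set where
    x-vertex : XStar i j w p (xv i j w p)
    q-vertex : ∀ t → XStar i j w p (qpen i j w p t)

  XStar-closed : ∀ {i j w p} → ClosedOutsideS (XStar i j w p)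
  XStar-closed (inj₁ (e-xy _ _ _ _))     x∉S y∉S x-vertex = ⊥-elim (y∉S (y∈S (x∉S⇒≡ x∉S)))
  XStar-closed (inj₁ (e-xline _ _ _ _))  x∉S ℓ∉S x-vertex = ⊥-elim (line∉S⇒≢ ℓ∉S (x∉S⇒≡ x∉S))
  XStar-closed (inj₂ (e-qpen _ _ _ _ t)) _   _   x-vertex = q-vertex t
  XStar-closed (inj₁ (e-qpen _ _ _ _ _)) _   _   (q-vertex _) = x-vertex
  XStar-closed (inj₂ (e-u _ _))          _   u∉S _        = ⊥-elim (u∉S (here refl))

  XStar-length≤ : ∀ {D i j w p x} → Unique D → IsComponent Adj′ (_∉ S) D → x ∈ D
    → XStar i j w p x → length D ≤ K′
  XStar-length≤ {D} {i} {j} {w} {p} unique-D D-comp x∈D Px =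
    -- suc (K′ ∸ 1) computes to K′, as K′ = 1 + ⋯
    subst (length D ≤_) (cong suc (trans (length-map _ (allFin (K′ ∸ 1))) (length-allFin _)))
      (length≤-cover unique-D D-comp (XStar i j w p) XStar-closed x∈D Px
        (xv i j w p ∷ map (qpen i j w p) (allFin (K′ ∸ 1))) cover)
    where
      cover : ∀ {v} → XStar i j w p v → v ∈ xv i j w p ∷ map (qpen i j w p) (allFin (K′ ∸ 1))
      cover x-vertex     = here refl
      cover (q-vertex t) = there (∈-map⁺ _ (∈-allFin t))

  data ZStar (i : Fin n) : V′ → Set where
    z-vertex : ZStar i (zv i)
    w-vertex : ∀ t → ZStar i (wpen i t)
    y-vertex : ∀ j w p → ZStar i (yv i j w p)

  ZStar-closed : ∀ {i} → ClosedOutsideS (ZStar i)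
  ZStar-closed (inj₁ (e-zy _ j w p)) _   _   z-vertex         = y-vertex j w p
  ZStar-closed (inj₂ (e-wpen _ t))   _   _   z-vertex         = w-vertex t
  ZStar-closed (inj₁ (e-wpen _ _))   _   _   (w-vertex _)     = z-vertex
  ZStar-closed (inj₂ (e-zy _ _ _ _)) _   _   (y-vertex _ _ _) = z-vertex
  ZStar-closed (inj₂ (e-xy _ _ _ _)) y∉S x∉S (y-vertex _ _ _) = ⊥-elim (y∉S⇒≢ y∉S (x∉S⇒≡ x∉S))
  ZStar-closed (inj₂ (e-u _ _))      _   u∉S _                = ⊥-elim (u∉S (here refl))

  zStarCover : Fin n → List V′
  zStarCover i = zv i ∷ map (wpen i) (allFin (K′ ∸ k * (deg G i + 1)))
                       ++ concatMap (λ j → map (λ (w , p) → yv i j w p) N[ i ]) (allFin k)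

  length-zStarCover : ∀ i → length (zStarCover i) ≡ suc K′
  length-zStarCover i = cong suc (begin
    length (ws ++ ys)                             ≡⟨ length-++ ws ⟩
    length ws + length ys                         ≡⟨ cong₂ _+_ (trans (length-map (wpen i) (allFin _)) (length-allFin _))
                                                               (length-concatMap-N i _) ⟩
    (K′ ∸ k * (deg G i + 1)) + k * (deg G i + 1)  ≡⟨ m∸n+n≡m (gadget-size≤K′ i) ⟩
    K′                                            ∎)
    where
      open ≡-Reasoning
      ws = map (wpen i) (allFin (K′ ∸ k * (deg G i + 1)))
      ys = concatMap (λ j → map (λ (w , p) → yv i j w p) N[ i ]) (allFin k)

  ZStar⊆cover : ∀ {i v} → ZStar i v → v ∈ zStarCover i
  ZStar⊆cover z-vertex         = here refl
  ZStar⊆cover (w-vertex t)     = there (∈-++⁺ˡ (∈-map⁺ _ (∈-allFin t)))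
  ZStar⊆cover {i} (y-vertex j w p) = there (∈-++⁺ʳ _ (∈-concatMap⁺ _ (lose (∈-allFin j)
    (∈-map⁺ (λ (w , p) → yv i j w p) (∈-witnesses⁺ (inN G i) (∈-allFin w) p)))))

  ZStar-length≤ : ∀ {D i x} → Unique D → IsComponent Adj′ (_∉ S) D → x ∈ D
    → ZStar i x → length D ≤ K′
  ZStar-length≤ {D} {i} unique-D D-comp x∈D Px = s≤s⁻¹ (begin
    length (y₀ ∷ D)        ≤⟨ length-mono-⊆ (All.tabulate y₀∉D ∷ unique-D) y₀∷D⊆cover ⟩
    length (zStarCover i)  ≡⟨ length-zStarCover i ⟩
    suc K′                 ∎)
    where
      open ≤-Reasoning
      dominator = proj₂ dominating i
      w₀∈K = proj₁ (proj₂ dominator)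
      y₀ = yv i (index w₀∈K) (proj₁ dominator) (proj₂ (proj₂ dominator))
      y₀∉D : ∀ {v} → v ∈ D → y₀ ≢ v
      y₀∉D v∈D refl = proj₁ (proj₂ D-comp) _ v∈D (y∈S (lookup-index w₀∈K))
      y₀∷D⊆cover : y₀ ∷ D ⊆ zStarCover i
      y₀∷D⊆cover (here refl)  = ZStar⊆cover (y-vertex _ _ _)
      y₀∷D⊆cover (there v∈D) = ZStar⊆cover (component-invariant D-comp (ZStar i) ZStar-closed x∈D Px v∈D)

  data Segment (j : Fin k) (b₀ : Fin n) : V′ → Set where
    on-line : ∀ {b a} → InSegment (toℕ (d j)) b₀ b (toℕ a) → Segment j b₀ (line j b a)
    pendant : ∀ {b t} → Succ b₀ b → 0 < toℕ (d j) → Segment j b₀ (bpen j b t)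

  Segment-closed : ∀ {j b₀} → ClosedOutsideS (Segment j b₀)
  Segment-closed {j} (inj₁ (e-cyc _ _ _ _ _ next)) _ ℓ′∉S (on-line seg) =
    on-line (InSegment-step (toℕ<n (d j)) seg (next⇒Step next) (line∉S⇒≢ ℓ′∉S ∘ toℕ-injective))
  Segment-closed {j} (inj₂ (e-cyc _ _ _ _ _ next)) _ ℓ′∉S (on-line seg) =
    on-line (InSegment-step⁻ (toℕ<n (d j)) seg (next⇒Step next) (line∉S⇒≢ ℓ′∉S ∘ toℕ-injective))
  Segment-closed (inj₂ (e-bpen _ _ _ _ a≡0)) _ _ (on-line (inj₁ (_ , d<a))) with () ← subst (_ <_) a≡0 d<a
  Segment-closed (inj₂ (e-bpen _ _ _ _ a≡0)) _ _ (on-line (inj₂ (succ , a<d))) =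
    pendant succ (subst (_< _) a≡0 a<d)
  Segment-closed (inj₂ (e-xline _ _ _ _)) ℓ∉S x∉S (on-line _) = ⊥-elim (line∉S⇒≢ ℓ∉S (x∉S⇒≡ x∉S))
  Segment-closed (inj₁ (e-bpen _ _ _ _ a≡0)) _ _ (pendant succ 0<d) =
    on-line (inj₂ (succ , subst (_< _) (sym a≡0) 0<d))
  Segment-closed (inj₂ (e-u _ _)) _ u∉S _ = ⊥-elim (u∉S (here refl))

  -- Distance along line j from the start of block b₀; the pendants count as lying after position n + d_j.
  segmentPosition : Fin k → Fin n → V′ → ℕ
  segmentPosition j b₀ (line _ b a) = toℕ a + (if ⌊ b ≟ b₀ ⌋ then 0 else n)
  segmentPosition j b₀ (bpen _ _ t) = n + toℕ (d j) + toℕ t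
  segmentPosition j b₀ _            = 0

  line-position-range : ∀ {j b₀ b a} → InSegment (toℕ (d j)) b₀ b (toℕ a)
    → toℕ (d j) < segmentPosition j b₀ (line j b a) × segmentPosition j b₀ (line j b a) < n + toℕ (d j)
  line-position-range {j} {b₀} {b} {a} seg with b ≟ b₀ | seg
  ... | yes _ | inj₁ (_ , d<a) =
    subst (_ <_) (sym (+-identityʳ _)) d<a ,
    subst (_< n + toℕ (d j)) (sym (+-identityʳ _)) (≤-trans (toℕ<n a) (m≤m+n n _))
  ... | yes refl | inj₂ (succ , a<d)
    with () ← ≤-trans a<d (s≤s⁻¹ (subst (toℕ (d j) <_) (Succ-refl⇒n≡1 succ) (toℕ<n (d j))))
  ... | no b≢b₀ | inj₁ (b≡b₀ , _) = ⊥-elim (b≢b₀ b≡b₀)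
  ... | no _    | inj₂ (_ , a<d) =
    ≤-trans (toℕ<n (d j)) (m≤n+m n (toℕ a)) , subst (_< n + toℕ (d j)) (+-comm n (toℕ a)) (+-monoʳ-< n a<d)

  segmentPosition-range : ∀ {j b₀ v} → Segment j b₀ v
    → suc (toℕ (d j)) ≤ segmentPosition j b₀ v × segmentPosition j b₀ v < suc (toℕ (d j)) + K′
  segmentPosition-range {j} (on-line seg) =
    let d<pos , pos<n+d = line-position-range seg in
    d<pos , m<n⇒m<1+n (≤-trans pos<n+d (≤-trans (+-monoˡ-≤ (toℕ (d j)) n≤K′) (≤-reflexive (+-comm K′ _))))
  segmentPosition-range {j} {b₀} (pendant {t = t} _ _) =
    ≤-trans (+-monoˡ-≤ (toℕ (d j)) (≤-trans (s≤s z≤n) (toℕ<n b₀))) (m≤m+n _ (toℕ t)) , s≤s (begin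
      n + toℕ (d j) + toℕ t          ≤⟨ +-monoʳ-≤ (n + toℕ (d j)) t≤K′∸n ⟩
      n + toℕ (d j) + (K′ ∸ n)       ≡⟨ cong (_+ (K′ ∸ n)) (+-comm n (toℕ (d j))) ⟩
      toℕ (d j) + n + (K′ ∸ n)       ≡⟨ +-assoc (toℕ (d j)) n (K′ ∸ n) ⟩
      toℕ (d j) + (n + (K′ ∸ n))     ≡⟨ cong (toℕ (d j) +_) (m+[n∸m]≡n n≤K′) ⟩
      toℕ (d j) + K′                 ∎)
    where
      open ≤-Reasoning
      t≤K′∸n : toℕ t ≤ K′ ∸ n
      t≤K′∸n = s≤s⁻¹ (subst (toℕ t <_) (+-comm (K′ ∸ n) 1) (toℕ<n t))

  segmentPosition-injective : ∀ {j b₀ v v′} → Segment j b₀ v → Segment j b₀ v′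
    → segmentPosition j b₀ v ≡ segmentPosition j b₀ v′ → v ≡ v′
  segmentPosition-injective {j} {b₀} (on-line {b} {a} seg) (on-line {b′} {a′} seg′) eq
    with b ≟ b₀ | b′ ≟ b₀ | seg | seg′
  ... | yes refl | yes refl | _ | _ = cong (line j b₀) (toℕ-injective (+-cancelʳ-≡ 0 _ _ eq))
  ... | no _ | no _ | inj₂ (succ , _) | inj₂ (succ′ , _) =
    cong₂ (line j) (Succ-functional succ succ′) (toℕ-injective (+-cancelʳ-≡ n _ _ eq))
  ... | no b≢b₀ | _ | inj₁ (b≡b₀ , _) | _ = ⊥-elim (b≢b₀ b≡b₀)
  ... | _ | no b′≢b₀ | _ | inj₁ (b′≡b₀ , _) = ⊥-elim (b′≢b₀ b′≡b₀)
  ... | yes _ | no _ | _ | _ =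
    ⊥-elim (<⇒≱ (subst (_< n) (sym (+-identityʳ _)) (toℕ<n a)) (subst (n ≤_) (sym eq) (m≤n+m n _)))
  ... | no _ | yes _ | _ | _ =
    ⊥-elim (<⇒≱ (subst (_< n) (sym (+-identityʳ _)) (toℕ<n a′)) (subst (n ≤_) eq (m≤n+m n _)))
  segmentPosition-injective {j} (pendant {t = t} succ _) (pendant {t = t′} succ′ _) eq =
    cong₂ (bpen j) (Succ-functional succ succ′) (toℕ-injective (+-cancelˡ-≡ (n + toℕ (d j)) _ _ eq))
  segmentPosition-injective {j} (on-line seg) (pendant {t = t} _ _) eq =
    ⊥-elim (<⇒≱ (proj₂ (line-position-range seg)) (subst (n + toℕ (d j) ≤_) (sym eq) (m≤m+n _ (toℕ t))))
  segmentPosition-injective {j} (pendant {t = t} _ _) (on-line seg) eq =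
    ⊥-elim (<⇒≱ (proj₂ (line-position-range seg)) (subst (n + toℕ (d j) ≤_) eq (m≤m+n _ (toℕ t))))

  Segment-length≤ : ∀ {D j b₀ x} → Unique D → IsComponent Adj′ (_∉ S) D → x ∈ D
    → Segment j b₀ x → length D ≤ K′
  Segment-length≤ {j = j} {b₀} unique-D D-comp x∈D Px =
    length≤-injective-into-interval (segmentPosition j b₀) (suc (toℕ (d j))) K′ unique-D
      (λ v∈D v′∈D → segmentPosition-injective (in-segment v∈D) (in-segment v′∈D))
      (segmentPosition-range ∘ in-segment)
    where
      in-segment = component-invariant D-comp (Segment j b₀) Segment-closed x∈D Px

  isolated-pendant : ∀ {j b t} → toℕ (d j) ≡ 0 → ClosedOutsideS (_≡ bpen j b t)
  isolated-pendant d≡0 (inj₁ (e-bpen _ _ _ _ a≡0)) _ ℓ∉S refl =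
    ⊥-elim (line∉S⇒≢ ℓ∉S (toℕ-injective (trans a≡0 (sym d≡0))))
  isolated-pendant _ (inj₂ (e-u _ _)) _ u∉S _ = ⊥-elim (u∉S (here refl))

  component-length≤ : ∀ D → Unique D → IsComponent Adj′ (_∉ S) D → length D ≤ K′
  component-length≤ []      _        (D≢[] , _)               = ⊥-elim (D≢[] refl)
  component-length≤ (x ∷ D) unique-D D-comp@(_ , outside , _) = by-class x (here refl) (outside x (here refl))
    where
      by-class : ∀ v → v ∈ x ∷ D → v ∉ S → length (x ∷ D) ≤ K′
      by-class (line j b a) v∈ v∉S with <-cmp (toℕ (d j)) (toℕ a)
      ... | tri< d<a _ _ = Segment-length≤ unique-D D-comp v∈ (on-line {j = j} {b₀ = b} (inj₁ (refl , d<a)))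
      ... | tri≈ _ d≡a _ = ⊥-elim (line∉S⇒≢ v∉S (toℕ-injective (sym d≡a)))
      ... | tri> _ _ a<d = let b₀ , succ = Succ-predecessor b in
        Segment-length≤ unique-D D-comp v∈ (on-line {j = j} {b₀ = b₀} (inj₂ (succ , a<d)))
      by-class (bpen j b t) v∈ v∉S with toℕ (d j) ℕ.≟ 0
      ... | yes d≡0 = ≤-trans (length≤-cover unique-D D-comp _ (isolated-pendant d≡0) v∈ refl
                                 (bpen j b t ∷ []) (λ { refl → here refl }))
                              (s≤s z≤n)
      ... | no  d≢0 = let b₀ , succ = Succ-predecessor b in
        Segment-length≤ unique-D D-comp v∈ (pendant {j = j} {b₀ = b₀} {t = t} succ (n≢0⇒n>0 d≢0))
      by-class (zv i)           v∈ _   = ZStar-length≤ unique-D D-comp v∈ z-vertex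
      by-class (wpen i t)       v∈ _   = ZStar-length≤ unique-D D-comp v∈ (w-vertex t)
      by-class (yv i j w p)     v∈ _   = ZStar-length≤ unique-D D-comp v∈ (y-vertex j w p)
      by-class (xv i j w p)     v∈ _   = XStar-length≤ unique-D D-comp v∈ x-vertex
      by-class (qpen i j w p t) v∈ _   = XStar-length≤ unique-D D-comp v∈ (q-vertex t)
      by-class uv               _  u∉S = ⊥-elim (u∉S (here refl))

  S-safe : IsSafeSet Adj′ S
  S-safe = IsSafeSet-of-universal Adj′-sym u-universal (here refl) Unique-S
    (λ D unique-D D-comp → subst (length D ≤_) (sym length-S) (component-length≤ D unique-D D-comp))

lemma1 : (G : SimpleGraph) (k : ℕ) → 1 ≤ k
    → (∃ λ (K : List (Fin′ G)) → IsDominatingSet G K × length K ≡ k)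
    → ∃ λ (S : List (Construction.V′ G k))
        → Unique S × length S ≡ k′ G k × IsSafeSet (Construction.Adj′ G k) S
lemma1 G _ k≥1 (K , dominating , refl) = S , Unique-S , length-S , S-safe
  where open SafeSetOfDominatingSet G K dominating k≥1
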